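{- Let $G=G_1\oplus G_2$, let $R_1,\dots,R_n,W_1,\dots,W_m,H\in G_1$ and $X_1,\dots,X_{m+2}\in G_2$, with $R=(R_1,\dots,R_n)$, $W=(W_1,\dots,W_m)$, $X=(X_1,\dots,X_{m+2})$. Then for every $j\in\{1,\dots,n\}$, $P_X(R,W,H)$ is Hurwitz equivalent to $P_X(R,W,H^{R_j})$.
   Context: Conjugation notation: $a^b=b^{ -1}ab$. $P_X(R,W,H)$ denotes the factorization in $G_1\oplus G_2$ given by $((R_1,1),\dots,(R_n,1),(W_1,X_1),\dots,(W_m,X_m),(H^{ -1},X_{m+1}),(H,X_{m+2}))$. The braid group $B_k$ acts on the right on tuples of group elements by $(f_1,\dots,f_k)\sigma_i=(f_1,\dots,f_{i-1},f_{i+1},f_{i+1}^{ -1}f_if_{i+1},f_{i+2},\dots,f_k)$, $(f_1,\dots,f_k)\sigma_i^{ -1}=(f_1,\dots,f_{i-1},f_if_{i+1}f_i^{ -1},f_i,f_{i+2},\dots,f_k)$; Hurwitz equivalent means in the same orbit. -}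

module Defs where

open import Level using (Level; _⊔_)
open import Algebra.Bundles using (Group)
import Algebra.Construct.DirectProduct as DP
open import Data.Nat using (ℕ; zero; suc; _+_)
open import Data.Fin using (Fin)
open import Data.List using (List; []; _∷_)
open import Data.List.Relation.Binary.Pointwise using (Pointwise)
open import Data.Vec as Vec using (Vec; lookup; toList; zip)
open import Data.Product using (_×_; _,_)

module Hurwitz {c ℓ} (G : Group c ℓ) where
  open Group G

  _^_ : Carrier → Carrier → Carrier
  a ^ b = (b ⁻¹ ∙ a) ∙ b

  -- right action of σ_{i+1} (0-based index i) on a tuple;
  -- acts as the identity if the index is out of range.
  σ : ℕ → List Carrier → List Carrier
  σ zero    (f ∷ g ∷ rest) = g ∷ (f ^ g) ∷ rest
  σ (suc i) (f ∷ rest)     = f ∷ σ i rest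
  σ _       fs             = fs

  σ⁻ : ℕ → List Carrier → List Carrier
  σ⁻ zero    (f ∷ g ∷ rest) = ((f ∙ g) ∙ f ⁻¹) ∷ f ∷ rest
  σ⁻ (suc i) (f ∷ rest)     = f ∷ σ⁻ i rest
  σ⁻ _       fs             = fs

  data HurwitzEquiv : List Carrier → List Carrier → Set (c ⊔ ℓ) where
    base : ∀ {xs ys} → Pointwise _≈_ xs ys → HurwitzEquiv xs ys
    fwd  : ∀ {xs ys} (i : ℕ) → HurwitzEquiv (σ i xs) ys → HurwitzEquiv xs ys
    bwd  : ∀ {xs ys} (i : ℕ) → HurwitzEquiv (σ⁻ i xs) ys → HurwitzEquiv xs ys

module _ {a b ℓ₁ ℓ₂} (G₁ : Group a ℓ₁) (G₂ : Group b ℓ₂) where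
  private
    module G₁ = Group G₁
    module G₂ = Group G₂

  P : ∀ {n m} → Vec G₂.Carrier (m + 2) → Vec G₁.Carrier n → Vec G₁.Carrier m
      → G₁.Carrier → List (G₁.Carrier × G₂.Carrier)
  P X R W H = toList (Vec.map (λ r → r , G₂.ε) R
                      Vec.++ zip (W Vec.++ (H G₁.⁻¹ Vec.∷ H Vec.∷ Vec.[])) X)

-- Let r = (R_j, 1). The pair (H⁻¹, X_{m+1}), (H, X_{m+2}) has product (1, X_{m+1} X_{m+2}),
-- which commutes with r. Sliding r to the right past the factors after it (each of them
-- gets conjugated by r⁻¹), the four braid moves σ₁σ₂σ₂σ₁ applied to r and the pair replace
-- the pair by its conjugate by r while r ends up where it was, because r is fixed by
-- conjugation with the product of the pair. Sliding r back undoes the conjugation of the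
-- intermediate factors, and conjugating by r = (R_j, 1) leaves the G₂-components alone.
module Submission where

open import Defs
open import Algebra.Bundles using (Group)
open import Algebra.Construct.DirectProduct using (group)
open import Data.Nat using (ℕ; _+_; zero; suc)
open import Data.Fin using (Fin; zero; suc)
open import Data.Vec using (Vec; lookup; []; _∷_)

open import Data.Product using (_,_)
open import Data.List as List using (List; []; _∷_; _++_)
open import Data.List.Properties using (++-assoc)
open import Data.List.Relation.Binary.Pointwise as Pointwise using (Pointwise; []; _∷_)
import Data.Vec as V
open import Data.Vec.Properties using (toList-++; zipWith-++)
import Algebra.Properties.Group as GroupProperties
import Relation.Binary.Reasoning.Setoid as SetoidReasoning
open import Relation.Binary.PropositionalEquality as ≡ using (_≡_; subst₂)

module HurwitzProperties {c ℓ} (G : Group c ℓ) where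
  open Group G
  open Hurwitz G
  open GroupProperties G using (ε⁻¹≈ε; ⁻¹-anti-homo-∙; ⁻¹-involutive)

  infix 4 _≋_
  _≋_ : List Carrier → List Carrier → Set _
  _≋_ = Pointwise _≈_

  ≋-refl : ∀ {xs} → xs ≋ xs
  ≋-refl = Pointwise.refl refl

  ≋-trans : ∀ {xs ys zs} → xs ≋ ys → ys ≋ zs → xs ≋ zs
  ≋-trans = Pointwise.transitive trans

  ^-cong : ∀ {a a′ b b′} → a ≈ a′ → b ≈ b′ → a ^ b ≈ a′ ^ b′
  ^-cong a≈a′ b≈b′ = ∙-cong (∙-cong (⁻¹-cong b≈b′) a≈a′) b≈b′

  ^-identityʳ : ∀ a → a ^ ε ≈ a
  ^-identityʳ a = trans (identityʳ _) (trans (∙-congʳ ε⁻¹≈ε) (identityˡ a))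

  ε-^ : ∀ b → ε ^ b ≈ ε
  ε-^ b = trans (∙-congʳ (identityʳ _)) (inverseˡ b)

  ^-∙ : ∀ a b c → (a ^ b) ^ c ≈ a ^ (b ∙ c)
  ^-∙ a b c = begin
    (c ⁻¹ ∙ ((b ⁻¹ ∙ a) ∙ b)) ∙ c  ≈⟨ ∙-congʳ (assoc _ _ _) ⟨
    ((c ⁻¹ ∙ (b ⁻¹ ∙ a)) ∙ b) ∙ c  ≈⟨ assoc _ _ _ ⟩
    (c ⁻¹ ∙ (b ⁻¹ ∙ a)) ∙ (b ∙ c)  ≈⟨ ∙-congʳ (assoc _ _ _) ⟨
    ((c ⁻¹ ∙ b ⁻¹) ∙ a) ∙ (b ∙ c)  ≈⟨ ∙-congʳ (∙-congʳ (⁻¹-anti-homo-∙ b c)) ⟨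
    ((b ∙ c) ⁻¹ ∙ a) ∙ (b ∙ c)     ∎
    where open SetoidReasoning setoid

  ^-inverseˡ : ∀ a b → a ^ (b ⁻¹ ∙ b) ≈ a
  ^-inverseˡ a b = trans (^-cong refl (inverseˡ b)) (^-identityʳ a)

  ⁻¹-^ : ∀ a b → (a ⁻¹) ^ b ≈ (a ^ b) ⁻¹
  ⁻¹-^ a b = sym (begin
    ((b ⁻¹ ∙ a) ∙ b) ⁻¹        ≈⟨ ⁻¹-anti-homo-∙ _ _ ⟩
    b ⁻¹ ∙ (b ⁻¹ ∙ a) ⁻¹       ≈⟨ ∙-congˡ (⁻¹-anti-homo-∙ _ _) ⟩
    b ⁻¹ ∙ (a ⁻¹ ∙ b ⁻¹ ⁻¹)    ≈⟨ ∙-congˡ (∙-congˡ (⁻¹-involutive b)) ⟩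
    b ⁻¹ ∙ (a ⁻¹ ∙ b)          ≈⟨ assoc _ _ _ ⟨
    (b ⁻¹ ∙ a ⁻¹) ∙ b          ∎)
    where open SetoidReasoning setoid

  -- The left entry produced by σ⁻: σ⁻ 0 (f ∷ g ∷ _) = (g ^⁻ f) ∷ f ∷ _.
  infixl 10 _^⁻_
  _^⁻_ : Carrier → Carrier → Carrier
  a ^⁻ b = (b ∙ a) ∙ b ⁻¹

  ^⁻-^ : ∀ a b → (a ^⁻ b) ^ b ≈ a
  ^⁻-^ a b = begin
    (b ⁻¹ ∙ ((b ∙ a) ∙ b ⁻¹)) ∙ b  ≈⟨ assoc _ _ _ ⟩
    b ⁻¹ ∙ (((b ∙ a) ∙ b ⁻¹) ∙ b)  ≈⟨ ∙-congˡ (assoc _ _ _) ⟩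
    b ⁻¹ ∙ ((b ∙ a) ∙ (b ⁻¹ ∙ b))  ≈⟨ ∙-congˡ (∙-congˡ (inverseˡ b)) ⟩
    b ⁻¹ ∙ ((b ∙ a) ∙ ε)           ≈⟨ ∙-congˡ (identityʳ _) ⟩
    b ⁻¹ ∙ (b ∙ a)                 ≈⟨ assoc _ _ _ ⟨
    (b ⁻¹ ∙ b) ∙ a                 ≈⟨ ∙-congʳ (inverseˡ b) ⟩
    ε ∙ a                          ≈⟨ identityˡ a ⟩
    a                              ∎
    where open SetoidReasoning setoid

  σ-cong : ∀ i {xs ys} → xs ≋ ys → σ i xs ≋ σ i ys
  σ-cong zero    (p ∷ q ∷ ps) = q ∷ ^-cong p q ∷ ps
  σ-cong zero    []           = []
  σ-cong zero    (p ∷ [])     = p ∷ []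
  σ-cong (suc i) []           = []
  σ-cong (suc i) (p ∷ ps)     = p ∷ σ-cong i ps

  σ⁻-cong : ∀ i {xs ys} → xs ≋ ys → σ⁻ i xs ≋ σ⁻ i ys
  σ⁻-cong zero    (p ∷ q ∷ ps) = ∙-cong (∙-cong p q) (⁻¹-cong p) ∷ p ∷ ps
  σ⁻-cong zero    []           = []
  σ⁻-cong zero    (p ∷ [])     = p ∷ []
  σ⁻-cong (suc i) []           = []
  σ⁻-cong (suc i) (p ∷ ps)     = p ∷ σ⁻-cong i ps

  HurwitzEquiv-respˡ : ∀ {xs xs′ ys} → xs′ ≋ xs → HurwitzEquiv xs ys → HurwitzEquiv xs′ ys
  HurwitzEquiv-respˡ p (base q)  = base (≋-trans p q)
  HurwitzEquiv-respˡ p (fwd i h) = fwd i (HurwitzEquiv-respˡ (σ-cong i p) h)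
  HurwitzEquiv-respˡ p (bwd i h) = bwd i (HurwitzEquiv-respˡ (σ⁻-cong i p) h)

  HurwitzEquiv-respʳ : ∀ {xs ys ys′} → HurwitzEquiv xs ys → ys ≋ ys′ → HurwitzEquiv xs ys′
  HurwitzEquiv-respʳ (base q)  p = base (≋-trans q p)
  HurwitzEquiv-respʳ (fwd i h) p = fwd i (HurwitzEquiv-respʳ h p)
  HurwitzEquiv-respʳ (bwd i h) p = bwd i (HurwitzEquiv-respʳ h p)

  HurwitzEquiv-refl : ∀ {xs} → HurwitzEquiv xs xs
  HurwitzEquiv-refl = base ≋-refl

  HurwitzEquiv-trans : ∀ {xs ys zs} → HurwitzEquiv xs ys → HurwitzEquiv ys zs → HurwitzEquiv xs zs
  HurwitzEquiv-trans (base p)  h = HurwitzEquiv-respˡ p h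
  HurwitzEquiv-trans (fwd i h) k = fwd i (HurwitzEquiv-trans h k)
  HurwitzEquiv-trans (bwd i h) k = bwd i (HurwitzEquiv-trans h k)

  HurwitzEquiv-∷ : ∀ a {xs ys} → HurwitzEquiv xs ys → HurwitzEquiv (a ∷ xs) (a ∷ ys)
  HurwitzEquiv-∷ a (base p)  = base (refl ∷ p)
  HurwitzEquiv-∷ a (fwd i h) = fwd (suc i) (HurwitzEquiv-∷ a h)
  HurwitzEquiv-∷ a (bwd i h) = bwd (suc i) (HurwitzEquiv-∷ a h)

  HurwitzEquiv-++ˡ : ∀ as {xs ys} → HurwitzEquiv xs ys → HurwitzEquiv (as ++ xs) (as ++ ys)
  HurwitzEquiv-++ˡ []       h = h
  HurwitzEquiv-++ˡ (a ∷ as) h = HurwitzEquiv-∷ a (HurwitzEquiv-++ˡ as h)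

  σ-HurwitzEquiv : ∀ i xs → HurwitzEquiv xs (σ i xs)
  σ-HurwitzEquiv i xs = fwd i HurwitzEquiv-refl

  σ⁻-HurwitzEquiv : ∀ i xs → HurwitzEquiv xs (σ⁻ i xs)
  σ⁻-HurwitzEquiv i xs = bwd i HurwitzEquiv-refl

  slide-right : ∀ r ts rest →
                HurwitzEquiv (r ∷ ts ++ rest) (List.map (_^⁻ r) ts ++ r ∷ rest)
  slide-right r []       rest = HurwitzEquiv-refl
  slide-right r (t ∷ ts) rest = HurwitzEquiv-trans
    (σ⁻-HurwitzEquiv 0 (r ∷ t ∷ ts ++ rest))
    (HurwitzEquiv-∷ (t ^⁻ r) (slide-right r ts rest))

  slide-left : ∀ r ts rest →
               HurwitzEquiv (ts ++ r ∷ rest) (r ∷ List.map (_^ r) ts ++ rest)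
  slide-left r []       rest = HurwitzEquiv-refl
  slide-left r (t ∷ ts) rest = HurwitzEquiv-trans
    (HurwitzEquiv-∷ t (slide-left r ts rest))
    (σ-HurwitzEquiv 0 (t ∷ r ∷ List.map (_^ r) ts ++ rest))

  map-^-map-^⁻ : ∀ r ts rest → List.map (_^ r) (List.map (_^⁻ r) ts) ++ rest ≋ ts ++ rest
  map-^-map-^⁻ r []       rest = ≋-refl
  map-^-map-^⁻ r (t ∷ ts) rest = ^⁻-^ t r ∷ map-^-map-^⁻ r ts rest

  conjugate-adjacent-pair : ∀ r h₁ h₂ rest → r ^ (h₁ ∙ h₂) ≈ r →
    HurwitzEquiv (r ∷ h₁ ∷ h₂ ∷ rest) (r ∷ h₁ ^ r ∷ h₂ ^ r ∷ rest)
  conjugate-adjacent-pair r h₁ h₂ rest r-fixed =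
    HurwitzEquiv-trans (σ-HurwitzEquiv 0 (r ∷ h₁ ∷ h₂ ∷ rest))
    (HurwitzEquiv-trans (σ-HurwitzEquiv 1 (h₁ ∷ r ^ h₁ ∷ h₂ ∷ rest))
    (HurwitzEquiv-respˡ (refl ∷ refl ∷ trans (^-∙ r h₁ h₂) r-fixed ∷ ≋-refl)
    (HurwitzEquiv-trans (σ-HurwitzEquiv 1 (h₁ ∷ h₂ ∷ r ∷ rest))
      (σ-HurwitzEquiv 0 (h₁ ∷ r ∷ h₂ ^ r ∷ rest)))))

  conjugate-pair : ∀ r ts h₁ h₂ rest → r ^ (h₁ ∙ h₂) ≈ r →
    HurwitzEquiv (r ∷ ts ++ h₁ ∷ h₂ ∷ rest) (r ∷ ts ++ h₁ ^ r ∷ h₂ ^ r ∷ rest)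
  conjugate-pair r ts h₁ h₂ rest r-fixed =
    HurwitzEquiv-trans (slide-right r ts (h₁ ∷ h₂ ∷ rest))
    (HurwitzEquiv-trans (HurwitzEquiv-++ˡ ts⁻ (conjugate-adjacent-pair r h₁ h₂ rest r-fixed))
    (HurwitzEquiv-respʳ (slide-left r ts⁻ (h₁ ^ r ∷ h₂ ^ r ∷ rest))
      (refl ∷ map-^-map-^⁻ r ts _)))
    where ts⁻ = List.map (_^⁻ r) ts

module _ {a b ℓ₁ ℓ₂} (G₁ : Group a ℓ₁) (G₂ : Group b ℓ₂) where
  private
    module G₁ = Group G₁
    module G₂ = Group G₂
    module H₁ = HurwitzProperties G₁
    module H₂ = HurwitzProperties G₂
    open Hurwitz G₁ using (_^_)
    G = group G₁ G₂
    module G = Group G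
    module H = HurwitzProperties G

  P-split : ∀ {n m} (X₁ : Vec G₂.Carrier m) x₁ x₂ (R : Vec G₁.Carrier n) W H →
    P G₁ G₂ (X₁ V.++ x₁ ∷ x₂ ∷ []) R W H
      ≡ V.toList (V.map (_, G₂.ε) R V.++ V.zip W X₁)
          ++ (H G₁.⁻¹ , x₁) ∷ (H , x₂) ∷ []
  P-split X₁ x₁ x₂ R W H = begin
    toList (Rs V.++ V.zip (W V.++ last₁) (X₁ V.++ last₂))
      ≡⟨ toList-++ Rs _ ⟩
    toList Rs ++ toList (V.zip (W V.++ last₁) (X₁ V.++ last₂))
      ≡⟨ ≡.cong (λ zs → toList Rs ++ toList zs) (zipWith-++ _,_ W last₁ X₁ last₂) ⟩
    toList Rs ++ toList (V.zip W X₁ V.++ V.zip last₁ last₂)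
      ≡⟨ ≡.cong (toList Rs ++_) (toList-++ (V.zip W X₁) _) ⟩
    toList Rs ++ (toList (V.zip W X₁) ++ toList (V.zip last₁ last₂))
      ≡⟨ ++-assoc (toList Rs) _ _ ⟨
    (toList Rs ++ toList (V.zip W X₁)) ++ toList (V.zip last₁ last₂)
      ≡⟨ ≡.cong (_++ _) (toList-++ Rs _) ⟨
    toList (Rs V.++ V.zip W X₁) ++ toList (V.zip last₁ last₂)
      ∎
    where
    open ≡.≡-Reasoning
    open V using (toList)
    Rs = V.map (_, G₂.ε) R
    last₁ = H G₁.⁻¹ ∷ H ∷ []
    last₂ = x₁ ∷ x₂ ∷ []

  P-conjugate-last-pair : ∀ {n m} r (R : Vec G₁.Carrier n) W H (X₁ : Vec G₂.Carrier m) x₁ x₂ →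
    let X = X₁ V.++ x₁ ∷ x₂ ∷ [] in
    Hurwitz.HurwitzEquiv G (P G₁ G₂ X (r ∷ R) W H) (P G₁ G₂ X (r ∷ R) W (H ^ r))
  P-conjugate-last-pair r R W H X₁ x₁ x₂ =
    subst₂ (Hurwitz.HurwitzEquiv G)
      (≡.cong ((r , G₂.ε) ∷_) (≡.sym (P-split X₁ x₁ x₂ R W H)))
      (≡.cong ((r , G₂.ε) ∷_) (≡.sym (P-split X₁ x₁ x₂ R W (H ^ r))))
      (H.HurwitzEquiv-respʳ
        (H.conjugate-pair (r , G₂.ε) ts (H G₁.⁻¹ , x₁) (H , x₂) []
          (H₁.^-inverseˡ r H , H₂.ε-^ (x₁ G₂.∙ x₂)))
        (G.refl ∷ Pointwise.++⁺ (H.≋-refl {ts})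
          ((H₁.⁻¹-^ H r , H₂.^-identityʳ x₁) ∷ (G₁.refl , H₂.^-identityʳ x₂) ∷ [])))
    where ts = V.toList (V.map (_, G₂.ε) R V.++ V.zip W X₁)

lemma3p4 : ∀ {a b ℓ₁ ℓ₂} (G₁ : Group a ℓ₁) (G₂ : Group b ℓ₂) (n m : ℕ)
    (R : Vec (Group.Carrier G₁) n) (W : Vec (Group.Carrier G₁) m)
    (H : Group.Carrier G₁) (X : Vec (Group.Carrier G₂) (m + 2))
    (j : Fin n) →
    Hurwitz.HurwitzEquiv (group G₁ G₂)
    (P G₁ G₂ X R W H)
    (P G₁ G₂ X R W (Hurwitz._^_ G₁ H (lookup R j)))
lemma3p4 G₁ G₂ (suc n) m (r ∷ R) W H X (suc j) =
  HurwitzProperties.HurwitzEquiv-∷ (group G₁ G₂) (r , Group.ε G₂) (lemma3p4 G₁ G₂ n m R W H X j)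
lemma3p4 G₁ G₂ (suc n) m (r ∷ R) W H X zero with V.splitAt m X
... | X₁ , x₁ ∷ x₂ ∷ [] , ≡.refl = P-conjugate-last-pair G₁ G₂ r R W H X₁ x₁ x₂
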